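{- Let $G$ be a finite simple graph, and let $G_1,G_2$ be subgraphs of $G$ with $V(G)=V(G_1)\cup V(G_2)$, $E(G)=E(G_1)\cup E(G_2)$, and let $H$ be the graph with $V(H)=V(G_1)\cap V(G_2)$ and $E(H)=E(G_1)\cap E(G_2)$. If $\frac{\mathbf{c}_1}{b_1}\in\mathcal{F}(G_1)$ and $\frac{\mathbf{c}_2}{b_2}\in\mathcal{F}(G_2)$ satisfy $i_{G_1}^H(\frac{\mathbf{c}_1}{b_1})=i_{G_2}^H(\frac{\mathbf{c}_2}{b_2})$, then there exists $\frac{\mathbf{c}}{b}\in\mathcal{F}(G)$ such that $i_G^{G_i}(\frac{\mathbf{c}}{b})=\frac{\mathbf{c}_i}{b_i}$ for $i\in\{1,2\}$ and $g_G(\frac{\mathbf{c}}{b})=\max\{g_{G_1}(\frac{\mathbf{c}_1}{b_1}),g_{G_2}(\frac{\mathbf{c}_2}{b_2})\}$.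
   Context: A $b$-fold coloring $\mathbf{c}$ of a graph assigns to each vertex a set of $b$ colors so that adjacent vertices receive disjoint sets; $A(\mathbf{c})$ is the set of colors used. Two $b$-fold colorings are isomorphic if they differ by a bijective renaming of colors. $\mathbf{c}_1+\mathbf{c}_2$ assigns each vertex the disjoint union of its color sets, and $t\cdot\mathbf{c}$ is the sum of $t$ copies. For $\mathbf{c}_1$ $b_1$-fold and $\mathbf{c}_2$ $b_2$-fold, $\mathbf{c}_1\sim\mathbf{c}_2$ if $sb_2\cdot\mathbf{c}_1$ and $sb_1\cdot\mathbf{c}_2$ are isomorphic for some positive integer $s$. The set $\mathcal{F}(G)$ of fractional colorings of $G$ is the set of $\sim$-classes of multifold colorings of $G$; the class of a $b$-fold coloring $\mathbf{c}$ is written $\frac{\mathbf{c}}{b}$. Let $g_G(\frac{\mathbf{c}}{b})=|A(\mathbf{c})|/b$. For a subgraph $H$ of $G$, restricting a multifold coloring of $G$ to $H$ induces a map $i_G^H\colon\mathcal{F}(G)\to\mathcal{F}(H)$. -}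

module Defs where

open import Data.Bool using (Bool; true; false; T; _∧_; _∨_)
open import Data.Nat using (ℕ; zero; suc; _+_; _*_; _≤_)
import Data.Nat as ℕ
open import Data.Fin using (Fin)
open import Data.List using (List; []; _∷_; _++_; map; filter; concat; length; deduplicate)
open import Data.List.Membership.Propositional using (_∈_)
open import Data.List.Relation.Unary.Unique.Propositional using (Unique)
open import Data.List.Fresh using ()
open import Data.Fin.Base using ()
open import Data.List.Base using ()
open import Data.Product using (Σ; ∃; _×_; _,_)
open import Data.Empty using (⊥)
open import Data.Integer using (+_)
open import Data.Rational using (ℚ; 0ℚ; _/_; _⊔_)
open import Function.Bundles using (_↔_; _⇔_; Inverse)
open import Relation.Binary.PropositionalEquality using (_≡_)
open import Relation.Nullary using (¬_)
open import Relation.Nullary.Decidable using (T?)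
import Data.List.Base as L
import Data.Vec.Functional as VF
open import Data.Fin.Base using (toℕ)

-- All graphs in the statement live inside the same ambient Fin n, so that
-- subgraphs, unions and intersections are expressed pointwise.
record Graph (n : ℕ) : Set where
  field
    V      : Fin n → Bool
    E      : Fin n → Fin n → Bool
    sym    : ∀ u v → T (E u v) → T (E v u)
    irrefl : ∀ v → ¬ T (E v v)
    edgeV  : ∀ u v → T (E u v) → T (V u)
open Graph public

_⊆G_ : ∀ {n} → Graph n → Graph n → Set
K ⊆G G = (∀ v → T (V K v) → T (V G v)) × (∀ u v → T (E K u v) → T (E G u v))

verts : ∀ {n} → Graph n → List (Fin n)
verts {n} K = L.filter (λ v → T? (V K v)) (L.allFin n)

-- Raw assignment of colour sets (colours are natural numbers, a colour set
-- is a duplicate-free list); only its values on vertices of the graph matter.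
Assignment : ℕ → Set
Assignment n = Fin n → List ℕ

Disjoint : List ℕ → List ℕ → Set
Disjoint xs ys = ∀ x → x ∈ xs → x ∈ ys → ⊥

record IsColoring {n} (K : Graph n) (b : ℕ) (c : Assignment n) : Set where
  field
    pos    : 1 ≤ b
    unique : ∀ v → T (V K v) → Unique (c v)
    size   : ∀ v → T (V K v) → length (c v) ≡ b
    proper : ∀ u v → T (E K u v) → Disjoint (c u) (c v)

usedColours : ∀ {n} → Graph n → Assignment n → List ℕ
usedColours K c = deduplicate Data.Nat._≟_ (concat (L.map c (verts K)))

numColours : ∀ {n} → Graph n → Assignment n → ℕ
numColours K c = length (usedColours K c)

_⊕_ : ∀ {n} → Assignment n → Assignment n → Assignment n
(c₁ ⊕ c₂) v = L.map (λ x → 2 * x) (c₁ v) ++ L.map (λ x → suc (2 * x)) (c₂ v)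

_·_ : ∀ {n} → ℕ → Assignment n → Assignment n
(zero  · c) v = []
(suc t · c) v = (c ⊕ (t · c)) v

Isomorphic : ∀ {n} → Graph n → Assignment n → Assignment n → Set
Isomorphic K c₁ c₂ =
  Σ (ℕ ↔ ℕ) λ σ → ∀ v → T (V K v) → ∀ x →
    (x ∈ c₁ v → Inverse.to σ x ∈ c₂ v) × (Inverse.to σ x ∈ c₂ v → x ∈ c₁ v)

-- c₁ (b₁-fold) ∼ c₂ (b₂-fold) on K: s b₂ · c₁ ≅ s b₁ · c₂ for some s ≥ 1.
-- Equality of fractional colourings c₁/b₁ = c₂/b₂ in 𝓕(K).
Equiv : ∀ {n} → Graph n → ℕ → Assignment n → ℕ → Assignment n → Set
Equiv K b₁ c₁ b₂ c₂ = ∃ λ s → 1 ≤ s × Isomorphic K ((s * b₂) · c₁) ((s * b₁) · c₂)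

-- a / b as a rational (b ≥ 1 in all uses; the b = 0 case is a dummy)
ratio : ℕ → ℕ → ℚ
ratio a zero    = 0ℚ
ratio a (suc k) = (+ a) / suc k

gval : ∀ {n} → Graph n → ℕ → Assignment n → ℚ
gval K b c = ratio (numColours K c) b

module Submission where

-- By symmetry we may assume
-- |A(c₂)|/b₂ ≤ |A(c₁)|/b₁.  Agreement on H provides s and a bijection σ of
-- the colours with (s b₂)·c₁ ≅ (s b₁)·c₂ on H.  With B = s b₁ b₂ the
-- colourings d₁ = (s b₂)·c₁ and d₂ = σ⁻¹ ∘ (s b₁)·c₂ are B-fold, have the
-- same colour sets on H, and |A(d₂)| ≤ |A(d₁)|.  So a renaming τ fixing
-- the colours used on H maps A(d₂) injectively into A(d₁), and gluing d₁
-- on G₁ with τ ∘ d₂ on the rest of G₂ gives a B-fold colouring c of G with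
-- c ≅ d₁ on G₁, c ≅ d₂ on G₂ and A(c) = A(d₁); hence g_G(c/B) = g_{G₁}(c₁/b₁),
-- which is the maximum.

open import Defs hiding (sym)
open import Data.Bool using (Bool; true; false; T; if_then_else_; _∧_; _∨_)
open import Data.Bool.Properties using (T-∧; T-∨; ∨-comm; ∧-comm)
open import Data.Empty using (⊥; ⊥-elim)
open import Data.Fin using (Fin) renaming (zero to fzero; suc to fsuc)
open import Data.Fin.Properties using (injective⇒≤)
open import Data.Integer using (+_)
import Data.Integer as ℤ
open import Data.Integer.Properties using (pos-*)
open import Data.List using (List; []; _∷_; _++_; map; filter; concat; length; lookup; allFin)
open import Data.List.Properties using (length-map; length-++)
open import Data.List.Membership.Propositional using (_∈_; _∉_)
open import Data.List.Membership.Propositional.Properties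
  using (∈-map⁺; ∈-map⁻; ∈-++⁺ˡ; ∈-++⁺ʳ; ∈-++⁻; ∈-filter⁺; ∈-filter⁻; ∈-lookup;
         ∈-concat⁺′; ∈-concat⁻′; ∈-deduplicate⁺; ∈-deduplicate⁻; ∈-allFin)
import Data.List.Membership.Setoid.Properties as SetoidMembership
open import Data.List.Relation.Unary.Any using (here; there; index; tail)
import Data.List.Relation.Unary.All as All
open import Data.List.Relation.Unary.AllPairs using ([]; _∷_)
open import Data.List.Relation.Unary.Unique.Propositional using (Unique)
import Data.List.Relation.Unary.Unique.Propositional.Properties as Unique
open import Data.Nat using (ℕ; zero; suc; _+_; _*_; _≤_; _<_; z≤n; s≤s; _≟_; NonZero; >-nonZero)
open import Data.Nat.DivMod
  using (_/_; _%_; m≡m%n+[m/n]*n; m%n<n; m<n*o⇒m/o<n; [m+kn]%n≡m%n; m<n⇒m%n≡m)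
open import Data.Nat.Properties
open import Data.List.Membership.DecPropositional _≟_ using (_∈?_)
open import Data.List.Relation.Unary.Unique.DecPropositional.Properties _≟_ using (deduplicate-!)
open import Data.Product using (Σ; _×_; _,_; proj₁; proj₂; map₁; map₂)
open import Data.Rational using (ℚ; _⊔_)
import Data.Rational as ℚ
open import Data.Rational.Properties
  using (fromℚᵘ-cong; toℚᵘ-cancel-≤; toℚᵘ-fromℚᵘ; p≥q⇒p⊔q≡p)
  renaming (⊔-comm to ℚ-⊔-comm)
open import Data.Rational.Unnormalised using (mkℚᵘ; *≡*; *≤*)
import Data.Rational.Unnormalised.Properties as ℚᵘ
open import Data.Sum using (_⊎_; inj₁; inj₂; [_,_]′)
open import Function using (_∘_)
open import Function.Bundles using (_↔_; Inverse; mk↔ₛ′; Equivalence)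
open import Function.Construct.Composition using (_↔-∘_)
open import Function.Construct.Identity using (↔-id)
open import Function.Construct.Symmetry using (↔-sym)
open import Relation.Binary.PropositionalEquality as ≡
  using (_≡_; _≢_; refl; sym; trans; cong; cong₂; subst; subst₂)
open import Relation.Nullary using (¬_; yes; no; ¬?)
open import Relation.Nullary.Decidable using (T?)
open import Relation.Unary using (Decidable)

lookup-injective : ∀ {A : Set} {xs : List A} → Unique xs →
  ∀ {i j} → lookup xs i ≡ lookup xs j → i ≡ j
lookup-injective (_   ∷ _) {fzero}  {fzero}  _ = refl
lookup-injective (x∉ ∷ _) {fzero}  {fsuc j} e = ⊥-elim (All.lookup x∉ (∈-lookup j) e)
lookup-injective (x∉ ∷ _) {fsuc i} {fzero}  e = ⊥-elim (All.lookup x∉ (∈-lookup i) (sym e))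
lookup-injective (_   ∷ u) {fsuc i} {fsuc j} e = cong fsuc (lookup-injective u e)

-- A duplicate-free list is no longer than any list containing its
-- elements: sending each position to the position of the same element in
-- the bigger list is injective.
unique-⊆⇒length-≤ : ∀ {A : Set} {xs ys : List A} → Unique xs →
  (∀ {z} → z ∈ xs → z ∈ ys) → length xs ≤ length ys
unique-⊆⇒length-≤ {xs = xs} {ys} u sub = injective⇒≤ position-injective
  where
  position : Fin (length xs) → Fin (length ys)
  position i = index (sub (∈-lookup i))
  position-injective : ∀ {i j} → position i ≡ position j → i ≡ j
  position-injective e = lookup-injective u
    (SetoidMembership.index-injective (≡.setoid _) (sub (∈-lookup _)) (sub (∈-lookup _)) e)

unique-same-length : ∀ {A : Set} {xs ys : List A} → Unique xs → Unique ys →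
  (∀ {z} → z ∈ xs → z ∈ ys) → (∀ {z} → z ∈ ys → z ∈ xs) → length xs ≡ length ys
unique-same-length u u' xs⊆ys ys⊆xs =
  ≤-antisym (unique-⊆⇒length-≤ u xs⊆ys) (unique-⊆⇒length-≤ u' ys⊆xs)

length-filter-split : ∀ {A : Set} {P : A → Set} (P? : Decidable P) (xs : List A) →
  length (filter P? xs) + length (filter (¬? ∘ P?) xs) ≡ length xs
length-filter-split P? [] = refl
length-filter-split P? (x ∷ xs) with P? x
... | yes _ = cong suc (length-filter-split P? xs)
... | no  _ = trans (+-suc _ _) (cong suc (length-filter-split P? xs))

InjectiveOn : List ℕ → (ℕ → ℕ) → Set
InjectiveOn L f = ∀ {x y} → x ∈ L → y ∈ L → f x ≡ f y → x ≡ y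

pairOff : List ℕ → List ℕ → ℕ → ℕ
pairOff (x ∷ xs) (y ∷ ys) z with z ≟ x
... | yes _ = y
... | no  _ = pairOff xs ys z
pairOff []       _        z = z
pairOff (_ ∷ _)  []       z = z

pairOff-outside : ∀ {xs ys z} → z ∉ xs → pairOff xs ys z ≡ z
pairOff-outside {[]}     {_}      _   = refl
pairOff-outside {x ∷ xs} {[]}     _   = refl
pairOff-outside {x ∷ xs} {y ∷ ys} {z} z∉ with z ≟ x
... | yes z≡x = ⊥-elim (z∉ (here z≡x))
... | no  _   = pairOff-outside (z∉ ∘ there)

pairOff-inside : ∀ {xs ys z} → length xs ≤ length ys → z ∈ xs → pairOff xs ys z ∈ ys
pairOff-inside {x ∷ xs} {y ∷ ys} {z} (s≤s le) z∈ with z ≟ x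
... | yes _   = here refl
... | no  z≢x = there (pairOff-inside le (tail z≢x z∈))

pairOff-injective : ∀ {xs ys} → Unique xs → Unique ys → length xs ≤ length ys →
  InjectiveOn xs (pairOff xs ys)
pairOff-injective {x ∷ xs} {y ∷ ys} (_ ∷ uxs) uys@(_ ∷ uys') (s≤s le) {z} {z'} z∈ z'∈ e
  with z ≟ x | z' ≟ x
... | yes refl | yes refl = refl
... | yes _    | no z'≢x  =
  ⊥-elim (Unique.Unique[x∷xs]⇒x∉xs uys (subst (_∈ ys) (sym e) (pairOff-inside le (tail z'≢x z'∈))))
... | no z≢x   | yes _    =
  ⊥-elim (Unique.Unique[x∷xs]⇒x∉xs uys (subst (_∈ ys) e (pairOff-inside le (tail z≢x z∈))))
... | no z≢x   | no z'≢x  =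
  pairOff-injective uxs uys' le (tail z≢x z∈) (tail z'≢x z'∈) e

record FixingInjection (S L₂ L₁ : List ℕ) : Set where
  field
    τ         : ℕ → ℕ
    into      : ∀ {x} → x ∈ L₂ → τ x ∈ L₁
    injective : InjectiveOn L₂ τ
    fixes     : ∀ {x} → x ∈ S → τ x ≡ x

-- If duplicate-free lists L₂ and L₁ with |L₂| ≤ |L₁| meet S in the same
-- elements, such a renaming exists: the elements of L₂ outside S are at most
-- as many as those of L₁ outside S, so they can be paired off with them.
fixing-injection : ∀ S {L₂ L₁} → Unique L₂ → Unique L₁ → length L₂ ≤ length L₁ →
  (∀ {x} → x ∈ S → x ∈ L₂ → x ∈ L₁) → (∀ {x} → x ∈ S → x ∈ L₁ → x ∈ L₂) →
  FixingInjection S L₂ L₁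
fixing-injection S {L₂} {L₁} u₂ u₁ |L₂|≤|L₁| S∩L₂⊆L₁ S∩L₁⊆L₂ =
  record { τ = τ ; into = into ; injective = injective ; fixes = fixes }
  where
  inS? : Decidable (_∈ S)
  inS? x = x ∈? S
  old new : List ℕ → List ℕ
  old L = filter inS? L
  new L = filter (¬? ∘ inS?) L

  old-length : length (old L₂) ≡ length (old L₁)
  old-length = unique-same-length (Unique.filter⁺ inS? u₂) (Unique.filter⁺ inS? u₁)
    (λ p → let (x∈L₂ , x∈S) = ∈-filter⁻ inS? {xs = L₂} p in ∈-filter⁺ inS? (S∩L₂⊆L₁ x∈S x∈L₂) x∈S)
    (λ p → let (x∈L₁ , x∈S) = ∈-filter⁻ inS? {xs = L₁} p in ∈-filter⁺ inS? (S∩L₁⊆L₂ x∈S x∈L₁) x∈S)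

  new-length : length (new L₂) ≤ length (new L₁)
  new-length = +-cancelˡ-≤ (length (old L₂)) _ _ (begin
    length (old L₂) + length (new L₂) ≡⟨ length-filter-split inS? L₂ ⟩
    length L₂                         ≤⟨ |L₂|≤|L₁| ⟩
    length L₁                         ≡⟨ length-filter-split inS? L₁ ⟨
    length (old L₁) + length (new L₁) ≡⟨ cong (_+ length (new L₁)) old-length ⟨
    length (old L₂) + length (new L₁) ∎)
    where open ≤-Reasoning

  τ : ℕ → ℕ
  τ = pairOff (new L₂) (new L₁)

  fixes : ∀ {x} → x ∈ S → τ x ≡ x
  fixes x∈S = pairOff-outside (λ p → proj₂ (∈-filter⁻ (¬? ∘ inS?) {xs = L₂} p) x∈S)

  τ-new : ∀ {x} → x ∈ L₂ → x ∉ S → τ x ∈ new L₁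
  τ-new x∈ x∉S = pairOff-inside new-length (∈-filter⁺ (¬? ∘ inS?) x∈ x∉S)

  τ-new∉S : ∀ {x} → x ∈ L₂ → x ∉ S → τ x ∉ S
  τ-new∉S x∈ x∉S = proj₂ (∈-filter⁻ (¬? ∘ inS?) {xs = L₁} (τ-new x∈ x∉S))

  into : ∀ {x} → x ∈ L₂ → τ x ∈ L₁
  into {x} x∈ with x ∈? S
  ... | yes x∈S = subst (_∈ L₁) (sym (fixes x∈S)) (S∩L₂⊆L₁ x∈S x∈)
  ... | no  x∉S = proj₁ (∈-filter⁻ (¬? ∘ inS?) {xs = L₁} (τ-new x∈ x∉S))

  injective : InjectiveOn L₂ τ
  injective {x} {y} x∈ y∈ e with x ∈? S | y ∈? S
  ... | yes x∈S | yes y∈S = trans (sym (fixes x∈S)) (trans e (fixes y∈S))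
  ... | yes x∈S | no  y∉S = ⊥-elim (τ-new∉S y∈ y∉S (subst (_∈ S) (trans (sym (fixes x∈S)) e) x∈S))
  ... | no  x∉S | yes y∈S = ⊥-elim (τ-new∉S x∈ x∉S (subst (_∈ S) (trans (sym (fixes y∈S)) (sym e)) y∈S))
  ... | no  x∉S | no  y∉S = pairOff-injective (Unique.filter⁺ (¬? ∘ inS?) u₂)
    (Unique.filter⁺ (¬? ∘ inS?) u₁) new-length
    (∈-filter⁺ (¬? ∘ inS?) x∈ x∉S) (∈-filter⁺ (¬? ∘ inS?) y∈ y∉S) e

open Inverse using (to; from; strictlyInverseˡ; strictlyInverseʳ)

to-injective : (σ : ℕ ↔ ℕ) → ∀ {x y} → to σ x ≡ to σ y → x ≡ y
to-injective σ {x} {y} e =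
  trans (sym (strictlyInverseʳ σ x)) (trans (cong (from σ) e) (strictlyInverseʳ σ y))

transpose : ℕ → ℕ → ℕ → ℕ
transpose a b x with x ≟ a
... | yes _ = b
... | no  _ with x ≟ b
...   | yes _ = a
...   | no  _ = x

transpose-a : ∀ a b → transpose a b a ≡ b
transpose-a a b with a ≟ a
... | yes _   = refl
... | no  a≢a = ⊥-elim (a≢a refl)

transpose-b : ∀ a b → transpose a b b ≡ a
transpose-b a b with b ≟ a
... | yes b≡a = b≡a
... | no  _ with b ≟ b
...   | yes _   = refl
...   | no  b≢b = ⊥-elim (b≢b refl)

transpose-other : ∀ a b x → x ≢ a → x ≢ b → transpose a b x ≡ x
transpose-other a b x x≢a x≢b with x ≟ a
... | yes x≡a = ⊥-elim (x≢a x≡a)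
... | no  _ with x ≟ b
...   | yes x≡b = ⊥-elim (x≢b x≡b)
...   | no  _   = refl

transpose-involutive : ∀ a b x → transpose a b (transpose a b x) ≡ x
transpose-involutive a b x with x ≟ a
... | yes refl = transpose-b a b
... | no  x≢a with x ≟ b
...   | yes refl = transpose-a a b
...   | no  x≢b  = transpose-other a b x x≢a x≢b

transposition : ℕ → ℕ → ℕ ↔ ℕ
transposition a b = mk↔ₛ′ (transpose a b) (transpose a b)
  (transpose-involutive a b) (transpose-involutive a b)

-- A map that is injective on a duplicate-free list agrees there with a
-- bijection of ℕ: extend it one element at a time, correcting the image of
-- the new element by a transposition.
extend-to-bijection : (L : List ℕ) → Unique L → (f : ℕ → ℕ) → InjectiveOn L f →
  Σ (ℕ ↔ ℕ) λ σ → ∀ {x} → x ∈ L → to σ x ≡ f x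
extend-to-bijection [] _ f _ = ↔-id ℕ , λ ()
extend-to-bijection (x ∷ L) (x∉L ∷ u) f f-inj
  with extend-to-bijection L u f (λ p q → f-inj (there p) (there q))
... | σ , σ≗f = transposition (to σ x) (f x) ↔-∘ σ , agrees
  where
  agrees : ∀ {y} → y ∈ x ∷ L → transpose (to σ x) (f x) (to σ y) ≡ f y
  agrees (here refl) = transpose-a (to σ x) (f x)
  agrees {y} (there y∈L) = trans (cong (transpose (to σ x) (f x)) (σ≗f y∈L))
    (transpose-other (to σ x) (f x) (f y)
      (λ e → All.lookup x∉L y∈L (sym (to-injective σ (trans (σ≗f y∈L) e))))
      (λ e → All.lookup x∉L y∈L (sym (f-inj (there y∈L) (here refl) e))))

module _ {n} (K : Graph n) (c : Assignment n) where

  used-∈⁺ : ∀ {v x} → T (V K v) → x ∈ c v → x ∈ usedColours K c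
  used-∈⁺ {v} v∈K x∈ = ∈-deduplicate⁺ _≟_ {xs = concat (map c (verts K))}
    (∈-concat⁺′ x∈ (∈-map⁺ c (∈-filter⁺ (λ w → T? (V K w)) (∈-allFin v) v∈K)))

  used-∈⁻ : ∀ {x} → x ∈ usedColours K c → Σ (Fin n) λ v → T (V K v) × x ∈ c v
  used-∈⁻ x∈ with ∈-concat⁻′ (map c (verts K)) (∈-deduplicate⁻ _≟_ (concat (map c (verts K))) x∈)
  ... | xs , x∈xs , xs∈ with ∈-map⁻ c {xs = verts K} xs∈
  ...   | v , v∈ , refl = v , proj₂ (∈-filter⁻ (λ w → T? (V K w)) {xs = allFin n} v∈) , x∈xs

  used-unique : Unique (usedColours K c)
  used-unique = deduplicate-! _

numColours-≡ : ∀ {n} (K K' : Graph n) (c c' : Assignment n) →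
  (∀ {x} → x ∈ usedColours K c → x ∈ usedColours K' c') →
  (∀ {x} → x ∈ usedColours K' c' → x ∈ usedColours K c) →
  numColours K c ≡ numColours K' c'
numColours-≡ K K' c c' = unique-same-length (used-unique K c) (used-unique K' c')

module _ {n} (K : Graph n) where

  same-sets-iso : ∀ {c c'} →
    (∀ v → T (V K v) → ∀ {x} → x ∈ c v → x ∈ c' v) →
    (∀ v → T (V K v) → ∀ {x} → x ∈ c' v → x ∈ c v) → Isomorphic K c c'
  same-sets-iso c⊆c' c'⊆c = ↔-id ℕ , λ v v∈K x → c⊆c' v v∈K , c'⊆c v v∈K

  iso-sym : ∀ {c c'} → Isomorphic K c c' → Isomorphic K c' c
  iso-sym {c} {c'} (σ , σ-iso) = ↔-sym σ , λ v v∈K x →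
    (λ x∈ → proj₂ (σ-iso v v∈K (from σ x)) (subst (_∈ c' v) (sym (strictlyInverseˡ σ x)) x∈)) ,
    (λ x∈ → subst (_∈ c' v) (strictlyInverseˡ σ x) (proj₁ (σ-iso v v∈K (from σ x)) x∈))

  iso-trans : ∀ {c c' c''} → Isomorphic K c c' → Isomorphic K c' c'' → Isomorphic K c c''
  iso-trans (σ , σ-iso) (ρ , ρ-iso) = ρ ↔-∘ σ , λ v v∈K x →
    (λ x∈ → proj₁ (ρ-iso v v∈K (to σ x)) (proj₁ (σ-iso v v∈K x) x∈)) ,
    (λ x∈ → proj₂ (σ-iso v v∈K x) (proj₂ (ρ-iso v v∈K (to σ x)) x∈))

  renaming-iso : ∀ {c c'} (f : ℕ → ℕ) → InjectiveOn (usedColours K c) f →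
    (∀ v → T (V K v) → ∀ {x} → x ∈ c v → f x ∈ c' v) →
    (∀ v → T (V K v) → ∀ {y} → y ∈ c' v → Σ ℕ λ x → x ∈ c v × f x ≡ y) →
    Isomorphic K c c'
  renaming-iso {c} {c'} f f-inj into onto
    with extend-to-bijection (usedColours K c) (used-unique K c) f f-inj
  ... | σ , σ≗f = σ , λ v v∈K x →
    (λ x∈ → subst (_∈ c' v) (sym (σ≗f (used-∈⁺ K c v∈K x∈))) (into v v∈K x∈)) ,
    (λ σx∈ → preimage v∈K (onto v v∈K σx∈))
    where
    preimage : ∀ {v x} → T (V K v) → (Σ ℕ λ x' → x' ∈ c v × f x' ≡ to σ x) → x ∈ c v
    preimage {v} v∈K (x' , x'∈ , e) =
      subst (_∈ c v) (to-injective σ (trans (σ≗f (used-∈⁺ K c v∈K x'∈)) e)) x'∈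

rename : ∀ {n} → (ℕ → ℕ) → Assignment n → Assignment n
rename f c v = map f (c v)

map-unique : ∀ (f : ℕ → ℕ) {xs} → Unique xs → InjectiveOn xs f → Unique (map f xs)
map-unique f {[]}     _          _     = []
map-unique f {x ∷ xs} (x∉ ∷ u) f-inj =
  All.tabulate fx∉ ∷ map-unique f u (λ p q → f-inj (there p) (there q))
  where
  fx∉ : ∀ {z} → z ∈ map f xs → f x ≢ z
  fx∉ z∈ e with ∈-map⁻ f z∈
  ... | y , y∈ , refl = All.lookup x∉ y∈ (f-inj (here refl) (there y∈) e)

module _ {n} (K : Graph n) {c : Assignment n} (f : ℕ → ℕ)
         (f-inj : InjectiveOn (usedColours K c) f) where

  rename-colouring : ∀ {b} → IsColoring K b c → IsColoring K b (rename f c)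
  rename-colouring {b} col = record
    { pos    = IsColoring.pos col
    ; unique = λ v v∈K → map-unique f (IsColoring.unique col v v∈K)
                 (λ p q → f-inj (used-∈⁺ K c v∈K p) (used-∈⁺ K c v∈K q))
    ; size   = λ v v∈K → trans (length-map f (c v)) (IsColoring.size col v v∈K)
    ; proper = proper }
    where
    proper : ∀ u v → T (E K u v) → Disjoint (rename f c u) (rename f c v)
    proper u v uv x p q with ∈-map⁻ f p | ∈-map⁻ f q
    ... | y , y∈ , refl | y' , y'∈ , e = IsColoring.proper col u v uv y y∈
      (subst (_∈ c v) (sym (f-inj (used-∈⁺ K c (edgeV K u v uv) y∈)
                                  (used-∈⁺ K c (edgeV K v u (Graph.sym K u v uv)) y'∈) e)) y'∈)

  rename-iso : Isomorphic K c (rename f c)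
  rename-iso = renaming-iso K f f-inj (λ v v∈K → ∈-map⁺ f)
    (λ v v∈K y∈ → let (x , x∈ , e) = ∈-map⁻ f y∈ in x , x∈ , sym e)

  rename-numColours : numColours K (rename f c) ≡ numColours K c
  rename-numColours = trans
    (unique-same-length (used-unique K (rename f c)) (map-unique f (used-unique K c) f-inj) fw bw)
    (length-map f (usedColours K c))
    where
    fw : ∀ {z} → z ∈ usedColours K (rename f c) → z ∈ map f (usedColours K c)
    fw z∈ with used-∈⁻ K (rename f c) z∈
    ... | v , v∈K , z∈cv with ∈-map⁻ f z∈cv
    ...   | y , y∈ , refl = ∈-map⁺ f (used-∈⁺ K c v∈K y∈)
    bw : ∀ {z} → z ∈ map f (usedColours K c) → z ∈ usedColours K (rename f c)
    bw z∈ with ∈-map⁻ f z∈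
    ... | y , y∈ , refl with used-∈⁻ K c y∈
    ...   | v , v∈K , y∈cv = used-∈⁺ K (rename f c) v∈K (∈-map⁺ f y∈cv)

-- In t · c the colour y of the i-th copy of c is code i y, since _⊕_ tags
-- the colours of its left summand by 2 * _ and those of its right one by
-- suc (2 * _).
code : ℕ → ℕ → ℕ
code zero    y = 2 * y
code (suc i) y = suc (2 * code i y)

half : ℕ → Bool × ℕ
half zero          = false , zero
half (suc zero)    = true , zero
half (suc (suc x)) = map₂ suc (half x)

half-even : ∀ y → half (2 * y) ≡ (false , y)
half-even zero    = refl
half-even (suc y) = trans (cong half (cong suc (+-suc y (y + 0))))
                          (cong (map₂ suc) (half-even y))

half-odd : ∀ y → half (suc (2 * y)) ≡ (true , y)
half-odd zero    = refl
half-odd (suc y) = trans (cong half (cong (suc ∘ suc) (+-suc y (y + 0))))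
                         (cong (map₂ suc) (half-odd y))

-- Decoding strips trailing 1-digits; the fuel argument bounds their number.
decodeWithin : ℕ → ℕ → ℕ × ℕ
decodeWithin zero     x = zero , proj₂ (half x)
decodeWithin (suc f) x with half x
... | false , h = zero , h
... | true  , h = map₁ suc (decodeWithin f h)

decode : ℕ → ℕ × ℕ
decode x = decodeWithin x x

-- Enough fuel: the number of trailing 1-digits of code i y is i ≤ code i y.
code-≥ : ∀ i y → i ≤ code i y
code-≥ zero    y = z≤n
code-≥ (suc i) y = s≤s (≤-trans (code-≥ i y) (m≤m+n (code i y) (code i y + 0)))

decodeWithin-code : ∀ f i y → i ≤ f → decodeWithin f (code i y) ≡ (i , y)
decodeWithin-code zero    zero    y _ rewrite half-even y = refl
decodeWithin-code (suc f) zero    y _ rewrite half-even y = refl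
decodeWithin-code (suc f) (suc i) y (s≤s i≤f)
  rewrite half-odd (code i y) | decodeWithin-code f i y i≤f = refl

decode-code : ∀ i y → decode (code i y) ≡ (i , y)
decode-code i y = decodeWithin-code (code i y) i y (code-≥ i y)

code-injective : ∀ {i j y z} → code i y ≡ code j z → i ≡ j × y ≡ z
code-injective {i} {j} {y} {z} e = cong proj₁ same , cong proj₂ same
  where
  same : (i , y) ≡ (j , z)
  same = trans (sym (decode-code i y)) (trans (cong decode e) (decode-code j z))

module _ {n} (c d : Assignment n) (v : Fin n) where

  ⊕-∈⁻ : ∀ {x} → x ∈ (c ⊕ d) v →
    (Σ ℕ λ y → y ∈ c v × x ≡ 2 * y) ⊎ (Σ ℕ λ y → y ∈ d v × x ≡ suc (2 * y))
  ⊕-∈⁻ x∈ with ∈-++⁻ (map (2 *_) (c v)) x∈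
  ... | inj₁ x∈ˡ = inj₁ (∈-map⁻ (2 *_) x∈ˡ)
  ... | inj₂ x∈ʳ = inj₂ (∈-map⁻ (suc ∘ (2 *_)) x∈ʳ)

  ⊕-∈⁺ˡ : ∀ {y} → y ∈ c v → 2 * y ∈ (c ⊕ d) v
  ⊕-∈⁺ˡ y∈ = ∈-++⁺ˡ (∈-map⁺ (2 *_) y∈)

  ⊕-∈⁺ʳ : ∀ {y} → y ∈ d v → suc (2 * y) ∈ (c ⊕ d) v
  ⊕-∈⁺ʳ y∈ = ∈-++⁺ʳ (map (2 *_) (c v)) (∈-map⁺ (suc ∘ (2 *_)) y∈)

module _ {n} (c : Assignment n) (v : Fin n) where

  ·-∈⁻ : ∀ t {x} → x ∈ (t · c) v → Σ ℕ λ i → i < t × Σ ℕ λ y → y ∈ c v × x ≡ code i y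
  ·-∈⁻ (suc t) x∈ with ⊕-∈⁻ c (t · c) v x∈
  ... | inj₁ (y , y∈ , refl) = zero , s≤s z≤n , y , y∈ , refl
  ... | inj₂ (z , z∈ , refl) with ·-∈⁻ t z∈
  ...   | i , i<t , y , y∈ , refl = suc i , s≤s i<t , y , y∈ , refl

  ·-∈⁺ : ∀ t {i y} → i < t → y ∈ c v → code i y ∈ (t · c) v
  ·-∈⁺ (suc t) {zero}  _         y∈ = ⊕-∈⁺ˡ c (t · c) v y∈
  ·-∈⁺ (suc t) {suc i} (s≤s i<t) y∈ = ⊕-∈⁺ʳ c (t · c) v (·-∈⁺ t i<t y∈)

tagged-unique : ∀ {xs ys : List ℕ} → Unique xs → Unique ys →
  Unique (map (2 *_) xs ++ map (suc ∘ (2 *_)) ys)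
tagged-unique {xs} {ys} u u' = Unique.++⁺
  (Unique.map⁺ (λ {x} {y} → *-cancelˡ-≡ x y 2) u)
  (Unique.map⁺ (λ {x} {y} → *-cancelˡ-≡ x y 2 ∘ suc-injective) u')
  (λ (p , q) → disjoint (∈-map⁻ (2 *_) p) (∈-map⁻ (suc ∘ (2 *_)) q))
  where
  disjoint : ∀ {z} → (Σ ℕ λ a → a ∈ xs × z ≡ 2 * a) → (Σ ℕ λ b → b ∈ ys × z ≡ suc (2 * b)) → ⊥
  disjoint (a , _ , refl) (b , _ , e) = even≢odd a b e

-- The conditions of a b-fold colouring without 1 ≤ b; unlike colourings
-- they hold for 0 · c, so they are what is preserved by ⊕ and by t · _.
record IsSetColouring {n} (K : Graph n) (b : ℕ) (c : Assignment n) : Set where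
  field
    unique : ∀ v → T (V K v) → Unique (c v)
    size   : ∀ v → T (V K v) → length (c v) ≡ b
    proper : ∀ u v → T (E K u v) → Disjoint (c u) (c v)

module _ {n} (K : Graph n) where

  ⊕-setColouring : ∀ {b b' c d} → IsSetColouring K b c → IsSetColouring K b' d →
    IsSetColouring K (b + b') (c ⊕ d)
  ⊕-setColouring {b} {b'} {c} {d} col col' = record
    { unique = λ v v∈K → tagged-unique (unique col v v∈K) (unique col' v v∈K)
    ; size   = λ v v∈K → trans (length-++ (map (2 *_) (c v)))
        (cong₂ _+_ (trans (length-map (2 *_) (c v)) (size col v v∈K))
                   (trans (length-map (suc ∘ (2 *_)) (d v)) (size col' v v∈K)))
    ; proper = disjoint }
    where
    open IsSetColouring
    disjoint : ∀ u v → T (E K u v) → Disjoint ((c ⊕ d) u) ((c ⊕ d) v)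
    disjoint u v uv z z∈u z∈v with ⊕-∈⁻ c d u z∈u | ⊕-∈⁻ c d v z∈v
    ... | inj₁ (a , a∈ , refl) | inj₁ (a' , a'∈ , e) =
      proper col u v uv a a∈ (subst (_∈ c v) (sym (*-cancelˡ-≡ a a' 2 e)) a'∈)
    ... | inj₁ (a , _ , refl)  | inj₂ (a' , _ , e)   = even≢odd a a' e
    ... | inj₂ (a , _ , refl)  | inj₁ (a' , _ , e)   = even≢odd a' a (sym e)
    ... | inj₂ (a , a∈ , refl) | inj₂ (a' , a'∈ , e) =
      proper col' u v uv a a∈ (subst (_∈ d v) (sym (*-cancelˡ-≡ a a' 2 (suc-injective e))) a'∈)

  ·-setColouring : ∀ {b c} → IsSetColouring K b c → ∀ t → IsSetColouring K (t * b) (t · c)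
  ·-setColouring col zero    = record
    { unique = λ _ _ → [] ; size = λ _ _ → refl ; proper = λ _ _ _ _ () }
  ·-setColouring col (suc t) = ⊕-setColouring col (·-setColouring col t)

  ·-colouring : ∀ {b c} → IsColoring K b c → ∀ t → 1 ≤ t → IsColoring K (t * b) (t · c)
  ·-colouring {b} {c} col t t≥1 = record
    { pos = *-mono-≤ t≥1 (IsColoring.pos col)
    ; unique = IsSetColouring.unique scaled
    ; size = IsSetColouring.size scaled
    ; proper = IsSetColouring.proper scaled }
    where
    scaled : IsSetColouring K (t * b) (t · c)
    scaled = ·-setColouring (record { unique = IsColoring.unique col
                                    ; size = IsColoring.size col
                                    ; proper = IsColoring.proper col }) t

  ⊕-numColours : ∀ c d → numColours K (c ⊕ d) ≡ numColours K c + numColours K d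
  ⊕-numColours c d = begin
    numColours K (c ⊕ d)                                  ≡⟨ unique-same-length
      (used-unique K (c ⊕ d)) (tagged-unique (used-unique K c) (used-unique K d)) fw bw ⟩
    length (map (2 *_) Ac ++ map (suc ∘ (2 *_)) Ad)       ≡⟨ length-++ (map (2 *_) Ac) ⟩
    length (map (2 *_) Ac) + length (map (suc ∘ (2 *_)) Ad)
      ≡⟨ cong₂ _+_ (length-map (2 *_) Ac) (length-map (suc ∘ (2 *_)) Ad) ⟩
    numColours K c + numColours K d                       ∎
    where
    open ≡.≡-Reasoning
    Ac Ad : List ℕ
    Ac = usedColours K c
    Ad = usedColours K d
    fw : ∀ {z} → z ∈ usedColours K (c ⊕ d) → z ∈ map (2 *_) Ac ++ map (suc ∘ (2 *_)) Ad
    fw z∈ with used-∈⁻ K (c ⊕ d) z∈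
    ... | v , v∈K , z∈v with ⊕-∈⁻ c d v z∈v
    ...   | inj₁ (y , y∈ , refl) = ∈-++⁺ˡ (∈-map⁺ (2 *_) (used-∈⁺ K c v∈K y∈))
    ...   | inj₂ (y , y∈ , refl) = ∈-++⁺ʳ (map (2 *_) Ac) (∈-map⁺ (suc ∘ (2 *_)) (used-∈⁺ K d v∈K y∈))
    bw : ∀ {z} → z ∈ map (2 *_) Ac ++ map (suc ∘ (2 *_)) Ad → z ∈ usedColours K (c ⊕ d)
    bw z∈ with ∈-++⁻ (map (2 *_) Ac) z∈
    ... | inj₁ z∈ˡ with ∈-map⁻ (2 *_) z∈ˡ
    ...   | y , y∈ , refl with used-∈⁻ K c y∈
    ...     | v , v∈K , y∈v = used-∈⁺ K (c ⊕ d) v∈K (⊕-∈⁺ˡ c d v y∈v)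
    bw z∈ | inj₂ z∈ʳ with ∈-map⁻ (suc ∘ (2 *_)) z∈ʳ
    ...   | y , y∈ , refl with used-∈⁻ K d y∈
    ...     | v , v∈K , y∈v = used-∈⁺ K (c ⊕ d) v∈K (⊕-∈⁺ʳ c d v y∈v)

  ·-numColours : ∀ c t → numColours K (t · c) ≡ t * numColours K c
  ·-numColours c zero    = unique-same-length (used-unique K (zero · c)) [] fw (λ ())
    where
    fw : ∀ {z} → z ∈ usedColours K (zero · c) → z ∈ []
    fw z∈ with used-∈⁻ K (zero · c) z∈
    ... | _ , _ , ()
  ·-numColours c (suc t) =
    trans (⊕-numColours c (t · c)) (cong (λ m → numColours K c + m) (·-numColours c t))

  -- c ≅ c' implies t · c ≅ t · c': rename every copy by the same bijection.
  ·-iso : ∀ {c c'} t → Isomorphic K c c' → Isomorphic K (t · c) (t · c')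
  ·-iso {c} {c'} t (σ , σ-iso) = renaming-iso K f f-inj into onto
    where
    f : ℕ → ℕ
    f x = code (proj₁ (decode x)) (to σ (proj₂ (decode x)))
    f-code : ∀ i y → f (code i y) ≡ code i (to σ y)
    f-code i y rewrite decode-code i y = refl
    into : ∀ v → T (V K v) → ∀ {x} → x ∈ (t · c) v → f x ∈ (t · c') v
    into v v∈K x∈ with ·-∈⁻ c v t x∈
    ... | i , i<t , y , y∈ , refl rewrite f-code i y = ·-∈⁺ c' v t i<t (proj₁ (σ-iso v v∈K y) y∈)
    onto : ∀ v → T (V K v) → ∀ {x'} → x' ∈ (t · c') v → Σ ℕ λ x → x ∈ (t · c) v × f x ≡ x'
    onto v v∈K x'∈ with ·-∈⁻ c' v t x'∈
    ... | i , i<t , y , y∈ , refl =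
      code i (from σ y) ,
      ·-∈⁺ c v t i<t (proj₂ (σ-iso v v∈K (from σ y)) (subst (_∈ c' v) (sym (strictlyInverseˡ σ y)) y∈)) ,
      trans (f-code i (from σ y)) (cong (code i) (strictlyInverseˡ σ y))
    f-inj : InjectiveOn (usedColours K (t · c)) f
    f-inj x∈ y∈ e with used-∈⁻ K (t · c) x∈ | used-∈⁻ K (t · c) y∈
    ... | v , _ , x∈v | w , _ , y∈w with ·-∈⁻ c v t x∈v | ·-∈⁻ c w t y∈w
    ...   | i , _ , a , _ , refl | j , _ , b , _ , refl
      with code-injective {i} {j} (trans (sym (f-code i a)) (trans e (f-code j b)))
    ...     | refl , σa≡σb = cong (code i) (to-injective σ σa≡σb)

digits-unique : ∀ {i j i' j' k} .{{_ : NonZero k}} → j < k → j' < k →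
  j + i * k ≡ j' + i' * k → i ≡ i' × j ≡ j'
digits-unique {i} {j} {i'} {j'} {k} j<k j'<k e = high , low
  where
  low : j ≡ j'
  low = begin
    j                 ≡⟨ m<n⇒m%n≡m j<k ⟨
    j % k             ≡⟨ [m+kn]%n≡m%n j i k ⟨
    (j + i * k) % k   ≡⟨ cong (_% k) e ⟩
    (j' + i' * k) % k ≡⟨ [m+kn]%n≡m%n j' i' k ⟩
    j' % k            ≡⟨ m<n⇒m%n≡m j'<k ⟩
    j'                ∎
    where open ≡.≡-Reasoning
  high : i ≡ i'
  high = *-cancelʳ-≡ i i' k (+-cancelˡ-≡ j (i * k) (i' * k) (trans e (cong (_+ i' * k) (sym low))))

module _ {n} (K : Graph n) where

  -- m · (k · c) ≅ (m * k) · c: colour y of copy j of copy i becomes colour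
  -- y of copy j + i * k.
  ·-·-iso : ∀ c m k .{{_ : NonZero k}} → Isomorphic K (m · (k · c)) ((m * k) · c)
  ·-·-iso c m k = renaming-iso K f f-inj into onto
    where
    f : ℕ → ℕ
    f x = let (i , z) = decode x ; (j , y) = decode z in code (j + i * k) y
    f-code : ∀ i j y → f (code i (code j y)) ≡ code (j + i * k) y
    f-code i j y rewrite decode-code i (code j y) | decode-code j y = refl
    digits-< : ∀ {i j} → i < m → j < k → j + i * k < m * k
    digits-< {i} {j} i<m j<k = ≤-trans (+-monoˡ-< (i * k) j<k) (*-monoˡ-≤ k i<m)
    into : ∀ v → T (V K v) → ∀ {x} → x ∈ (m · (k · c)) v → f x ∈ ((m * k) · c) v
    into v v∈K x∈ with ·-∈⁻ (k · c) v m x∈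
    ... | i , i<m , z , z∈ , refl with ·-∈⁻ c v k z∈
    ...   | j , j<k , y , y∈ , refl rewrite f-code i j y = ·-∈⁺ c v (m * k) (digits-< i<m j<k) y∈
    onto : ∀ v → T (V K v) → ∀ {x'} → x' ∈ ((m * k) · c) v →
      Σ ℕ λ x → x ∈ (m · (k · c)) v × f x ≡ x'
    onto v v∈K x'∈ with ·-∈⁻ c v (m * k) x'∈
    ... | l , l<mk , y , y∈ , refl =
      code (l / k) (code (l % k) y) ,
      ·-∈⁺ (k · c) v m (m<n*o⇒m/o<n l<mk) (·-∈⁺ c v k (m%n<n l k) y∈) ,
      trans (f-code (l / k) (l % k) y) (cong (λ l' → code l' y) (sym (m≡m%n+[m/n]*n l k)))
    f-inj : InjectiveOn (usedColours K (m · (k · c))) f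
    f-inj x∈ x'∈ e with used-∈⁻ K (m · (k · c)) x∈ | used-∈⁻ K (m · (k · c)) x'∈
    ... | v , _ , x∈v | w , _ , x'∈w with ·-∈⁻ (k · c) v m x∈v | ·-∈⁻ (k · c) w m x'∈w
    ...   | i , _ , z , z∈ , refl | i' , _ , z' , z'∈ , refl with ·-∈⁻ c v k z∈ | ·-∈⁻ c w k z'∈
    ...     | j , j<k , y , _ , refl | j' , j'<k , y' , _ , refl
      with code-injective {j + i * k} {j' + i' * k} (trans (sym (f-code i j y)) (trans e (f-code i' j' y')))
    ...       | same-digits , refl with digits-unique {i} {j} {i'} {j'} j<k j'<k same-digits
    ...         | refl , refl = refl

module _ {n} (K : Graph n) where

  -- A B-fold c isomorphic to k · c' for a b'-fold c' with B = k * b'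
  -- represents the same fractional colouring: b' · c ≅ b' · (k · c') ≅ (b' * k) · c'.
  iso-multiple⇒equiv : ∀ {B b' c c'} k .{{_ : NonZero k}} → B ≡ k * b' →
    Isomorphic K c (k · c') → Equiv K B c b' c'
  iso-multiple⇒equiv {B} {b'} {c} {c'} k B≡kb' c≅kc' = 1 , ≤-refl ,
    subst (λ m → Isomorphic K ((1 * b') · c) (m · c')) same-multiple
      (iso-trans K (·-iso K (1 * b') c≅kc') (·-·-iso K c' (1 * b') k))
    where
    same-multiple : (1 * b') * k ≡ 1 * B
    same-multiple = begin
      (1 * b') * k ≡⟨ cong (_* k) (*-identityˡ b') ⟩
      b' * k       ≡⟨ *-comm b' k ⟩
      k * b'       ≡⟨ B≡kb' ⟨
      B            ≡⟨ *-identityˡ B ⟨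
      1 * B        ∎
      where open ≡.≡-Reasoning

ratio-≡ : ∀ {a b a' b'} → 1 ≤ b → 1 ≤ b' → a * b' ≡ a' * b → ratio a b ≡ ratio a' b'
ratio-≡ {a} {suc k} {a'} {suc k'} _ _ e = fromℚᵘ-cong {mkℚᵘ (+ a) k} {mkℚᵘ (+ a') k'}
  (*≡* (trans (sym (pos-* a (suc k'))) (trans (cong +_ e) (pos-* a' (suc k)))))

ratio-≤ : ∀ {a b a' b'} → 1 ≤ b → 1 ≤ b' → a * b' ≤ a' * b → ratio a b ℚ.≤ ratio a' b'
ratio-≤ {a} {suc k} {a'} {suc k'} _ _ le = toℚᵘ-cancel-≤
  (ℚᵘ.≤-respˡ-≃ (ℚᵘ.≃-sym (toℚᵘ-fromℚᵘ (mkℚᵘ (+ a) k)))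
  (ℚᵘ.≤-respʳ-≃ (ℚᵘ.≃-sym (toℚᵘ-fromℚᵘ (mkℚᵘ (+ a') k')))
    (*≤* (subst₂ ℤ._≤_ (pos-* a (suc k')) (pos-* a' (suc k)) (ℤ.+≤+ le)))))

record CommonExtension {n} (G G₁ G₂ : Graph n)
    (b₁ : ℕ) (c₁ : Assignment n) (b₂ : ℕ) (c₂ : Assignment n) (g : ℚ) : Set where
  constructor extension
  field
    fold        : ℕ
    colouring   : Assignment n
    isColouring : IsColoring G fold colouring
    restricts₁  : Equiv G₁ fold colouring b₁ c₁
    restricts₂  : Equiv G₂ fold colouring b₂ c₂
    value       : gval G fold colouring ≡ g

module Gluing {n} (G G₁ G₂ H : Graph n)
  (V-union : ∀ v → V G v ≡ V G₁ v ∨ V G₂ v)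
  (E-union : ∀ u v → E G u v ≡ E G₁ u v ∨ E G₂ u v)
  (V-meet : ∀ v → V H v ≡ V G₁ v ∧ V G₂ v)
  {b₁ c₁} (col₁ : IsColoring G₁ b₁ c₁) {b₂ c₂} (col₂ : IsColoring G₂ b₂ c₂)
  (s : ℕ) (s≥1 : 1 ≤ s) (H-iso : Isomorphic H ((s * b₂) · c₁) ((s * b₁) · c₂))
  (dominant : numColours G₂ c₂ * b₁ ≤ numColours G₁ c₁ * b₂)
  where

  H⇒G₁ : ∀ {v} → T (V H v) → T (V G₁ v)
  H⇒G₁ {v} v∈H = proj₁ (Equivalence.to T-∧ (subst T (V-meet v) v∈H))

  H⇒G₂ : ∀ {v} → T (V H v) → T (V G₂ v)
  H⇒G₂ {v} v∈H = proj₂ (Equivalence.to T-∧ (subst T (V-meet v) v∈H))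

  G₁∩G₂⇒H : ∀ {v} → T (V G₁ v) → T (V G₂ v) → T (V H v)
  G₁∩G₂⇒H {v} v∈G₁ v∈G₂ = subst T (sym (V-meet v)) (Equivalence.from T-∧ (v∈G₁ , v∈G₂))

  G₁⇒G : ∀ {v} → T (V G₁ v) → T (V G v)
  G₁⇒G {v} v∈G₁ = subst T (sym (V-union v)) (Equivalence.from T-∨ (inj₁ v∈G₁))

  G⇒G₁∪G₂ : ∀ {v} → T (V G v) → T (V G₁ v) ⊎ T (V G₂ v)
  G⇒G₁∪G₂ {v} v∈G = Equivalence.to T-∨ (subst T (V-union v) v∈G)

  -- Step 1: scale both colourings to the common fold B and rename the colours
  -- of the second by σ⁻¹, so that d₁ and d₂ coincide on H.
  k₁ k₂ B : ℕ
  k₁ = s * b₂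
  k₂ = s * b₁
  B  = k₁ * b₁

  k₁≥1 : 1 ≤ k₁
  k₁≥1 = *-mono-≤ s≥1 (IsColoring.pos col₂)

  k₂≥1 : 1 ≤ k₂
  k₂≥1 = *-mono-≤ s≥1 (IsColoring.pos col₁)

  instance
    k₁-nonZero : NonZero k₁
    k₁-nonZero = >-nonZero k₁≥1
    k₂-nonZero : NonZero k₂
    k₂-nonZero = >-nonZero k₂≥1

  B-folds : k₂ * b₂ ≡ B
  B-folds = begin
    (s * b₁) * b₂ ≡⟨ *-assoc s b₁ b₂ ⟩
    s * (b₁ * b₂) ≡⟨ cong (s *_) (*-comm b₁ b₂) ⟩
    s * (b₂ * b₁) ≡⟨ *-assoc s b₂ b₁ ⟨
    (s * b₂) * b₁ ∎
    where open ≡.≡-Reasoning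

  σ : ℕ ↔ ℕ
  σ = proj₁ H-iso

  from-σ-injective : ∀ {L} → InjectiveOn L (from σ)
  from-σ-injective _ _ = to-injective (↔-sym σ)

  d₁ d₂ : Assignment n
  d₁ = k₁ · c₁
  d₂ = rename (from σ) (k₂ · c₂)

  d₁-colouring : IsColoring G₁ B d₁
  d₁-colouring = ·-colouring G₁ col₁ k₁ k₁≥1

  d₂-colouring : IsColoring G₂ B d₂
  d₂-colouring = subst (λ b → IsColoring G₂ b d₂) B-folds
    (rename-colouring G₂ (from σ) from-σ-injective (·-colouring G₂ col₂ k₂ k₂≥1))

  H-agree⁺ : ∀ {v} → T (V H v) → ∀ {x} → x ∈ d₁ v → x ∈ d₂ v
  H-agree⁺ {v} v∈H {x} x∈ =
    subst (_∈ d₂ v) (strictlyInverseʳ σ x) (∈-map⁺ (from σ) (proj₁ (proj₂ H-iso v v∈H x) x∈))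

  H-agree⁻ : ∀ {v} → T (V H v) → ∀ {x} → x ∈ d₂ v → x ∈ d₁ v
  H-agree⁻ {v} v∈H x∈ with ∈-map⁻ (from σ) x∈
  ... | y , y∈ , refl = proj₂ (proj₂ H-iso v v∈H (from σ y))
    (subst (_∈ (k₂ · c₂) v) (sym (strictlyInverseˡ σ y)) y∈)

  -- Step 2: d₂ uses no more colours than d₁, and both use the colours A_H
  -- of H; rename the colours of d₂ into those of d₁, fixing A_H.
  A₁ A₂ A_H : List ℕ
  A₁  = usedColours G₁ d₁
  A₂  = usedColours G₂ d₂
  A_H = usedColours H d₁

  |A₂|≤|A₁| : length A₂ ≤ length A₁
  |A₂|≤|A₁| = begin
    numColours G₂ d₂              ≡⟨ rename-numColours G₂ (from σ) from-σ-injective ⟩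
    numColours G₂ (k₂ · c₂)       ≡⟨ ·-numColours G₂ c₂ k₂ ⟩
    (s * b₁) * N₂                 ≡⟨ *-assoc s b₁ N₂ ⟩
    s * (b₁ * N₂)                 ≡⟨ cong (s *_) (*-comm b₁ N₂) ⟩
    s * (N₂ * b₁)                 ≤⟨ *-monoʳ-≤ s dominant ⟩
    s * (N₁ * b₂)                 ≡⟨ cong (s *_) (*-comm N₁ b₂) ⟩
    s * (b₂ * N₁)                 ≡⟨ *-assoc s b₂ N₁ ⟨
    (s * b₂) * N₁                 ≡⟨ ·-numColours G₁ c₁ k₁ ⟨
    numColours G₁ d₁              ∎
    where
    open ≤-Reasoning
    N₁ N₂ : ℕ
    N₁ = numColours G₁ c₁
    N₂ = numColours G₂ c₂

  recolouring : FixingInjection A_H A₂ A₁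
  recolouring = fixing-injection A_H (used-unique G₂ d₂) (used-unique G₁ d₁) |A₂|≤|A₁|
    (λ x∈A_H _ → let (v , v∈H , x∈) = used-∈⁻ H d₁ x∈A_H in used-∈⁺ G₁ d₁ (H⇒G₁ v∈H) x∈)
    (λ x∈A_H _ → let (v , v∈H , x∈) = used-∈⁻ H d₁ x∈A_H in used-∈⁺ G₂ d₂ (H⇒G₂ v∈H) (H-agree⁺ v∈H x∈))
  open FixingInjection recolouring

  e₂ : Assignment n
  e₂ = rename τ d₂

  c : Assignment n
  c v = if V G₁ v then d₁ v else e₂ v

  c-on-G₁ : ∀ {v} → T (V G₁ v) → c v ≡ d₁ v
  c-on-G₁ {v} v∈G₁ with V G₁ v
  ... | true = refl

  c-off-G₁ : ∀ {v} → ¬ T (V G₁ v) → c v ≡ e₂ v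
  c-off-G₁ {v} v∉G₁ with V G₁ v
  ... | true  = ⊥-elim (v∉G₁ _)
  ... | false = refl

  -- On G₂, c agrees with e₂ colour by colour: on H because τ fixes A_H.
  c-on-G₂⁺ : ∀ {v} → T (V G₂ v) → ∀ {x} → x ∈ c v → x ∈ e₂ v
  c-on-G₂⁺ {v} v∈G₂ {x} x∈ with T? (V G₁ v)
  ... | no  v∉G₁ = subst (x ∈_) (c-off-G₁ v∉G₁) x∈
  ... | yes v∈G₁ = subst (_∈ e₂ v) (fixes (used-∈⁺ H d₁ v∈H x∈d₁)) (∈-map⁺ τ (H-agree⁺ v∈H x∈d₁))
    where
    v∈H : T (V H v)
    v∈H = G₁∩G₂⇒H v∈G₁ v∈G₂
    x∈d₁ : x ∈ d₁ v
    x∈d₁ = subst (x ∈_) (c-on-G₁ v∈G₁) x∈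

  c-on-G₂⁻ : ∀ {v} → T (V G₂ v) → ∀ {x} → x ∈ e₂ v → x ∈ c v
  c-on-G₂⁻ {v} v∈G₂ {x} x∈ with T? (V G₁ v)
  ... | no  v∉G₁ = subst (x ∈_) (sym (c-off-G₁ v∉G₁)) x∈
  ... | yes v∈G₁ with ∈-map⁻ τ x∈
  ...   | y , y∈ , refl = subst (_∈ c v) (sym (fixes (used-∈⁺ H d₁ v∈H y∈d₁)))
                            (subst (y ∈_) (sym (c-on-G₁ v∈G₁)) y∈d₁)
    where
    v∈H : T (V H v)
    v∈H = G₁∩G₂⇒H v∈G₁ v∈G₂
    y∈d₁ : y ∈ d₁ v
    y∈d₁ = H-agree⁻ v∈H y∈

  e₂-colouring : IsColoring G₂ B e₂
  e₂-colouring = rename-colouring G₂ τ injective d₂-colouring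

  c-cases : ∀ {v} → T (V G v) → (T (V G₁ v) × c v ≡ d₁ v) ⊎ (T (V G₂ v) × c v ≡ e₂ v)
  c-cases {v} v∈G with T? (V G₁ v)
  ... | yes v∈G₁ = inj₁ (v∈G₁ , c-on-G₁ v∈G₁)
  ... | no  v∉G₁ with G⇒G₁∪G₂ v∈G
  ...   | inj₁ v∈G₁ = ⊥-elim (v∉G₁ v∈G₁)
  ...   | inj₂ v∈G₂ = inj₂ (v∈G₂ , c-off-G₁ v∉G₁)

  c-colouring : IsColoring G B c
  c-colouring = record
    { pos    = IsColoring.pos d₁-colouring
    ; unique = λ v v∈G → [ (λ (v∈G₁ , e) → subst Unique (sym e) (IsColoring.unique d₁-colouring v v∈G₁))
                         , (λ (v∈G₂ , e) → subst Unique (sym e) (IsColoring.unique e₂-colouring v v∈G₂)) ]′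
                         (c-cases v∈G)
    ; size   = λ v v∈G → [ (λ (v∈G₁ , e) → trans (cong length e) (IsColoring.size d₁-colouring v v∈G₁))
                         , (λ (v∈G₂ , e) → trans (cong length e) (IsColoring.size e₂-colouring v v∈G₂)) ]′
                         (c-cases v∈G)
    ; proper = proper }
    where
    proper : ∀ u v → T (E G u v) → Disjoint (c u) (c v)
    proper u v uv x x∈u x∈v with Equivalence.to T-∨ (subst T (E-union u v) uv)
    ... | inj₁ uv∈G₁ = IsColoring.proper d₁-colouring u v uv∈G₁ x
      (subst (x ∈_) (c-on-G₁ (edgeV G₁ u v uv∈G₁)) x∈u)
      (subst (x ∈_) (c-on-G₁ (edgeV G₁ v u (Graph.sym G₁ u v uv∈G₁))) x∈v)
    ... | inj₂ uv∈G₂ = IsColoring.proper e₂-colouring u v uv∈G₂ x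
      (c-on-G₂⁺ (edgeV G₂ u v uv∈G₂) x∈u)
      (c-on-G₂⁺ (edgeV G₂ v u (Graph.sym G₂ u v uv∈G₂)) x∈v)

  c≅d₁ : Isomorphic G₁ c (k₁ · c₁)
  c≅d₁ = same-sets-iso G₁ (λ v v∈G₁ {x} → subst (x ∈_) (c-on-G₁ v∈G₁))
                       (λ v v∈G₁ {x} → subst (x ∈_) (sym (c-on-G₁ v∈G₁)))

  c≅k₂c₂ : Isomorphic G₂ c (k₂ · c₂)
  c≅k₂c₂ = iso-trans G₂ (same-sets-iso G₂ (λ v → c-on-G₂⁺) (λ v → c-on-G₂⁻))
          (iso-trans G₂ (iso-sym G₂ (rename-iso G₂ τ injective))
                              (iso-sym G₂ (rename-iso G₂ (from σ) from-σ-injective)))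

  -- c uses exactly the colours of d₁, since τ maps the colours of d₂ into them.
  c-numColours : numColours G c ≡ numColours G₁ d₁
  c-numColours = numColours-≡ G G₁ c d₁ fw bw
    where
    fw : ∀ {x} → x ∈ usedColours G c → x ∈ A₁
    fw x∈ with used-∈⁻ G c x∈
    ... | v , v∈G , x∈cv with c-cases v∈G
    ...   | inj₁ (v∈G₁ , e) = used-∈⁺ G₁ d₁ v∈G₁ (subst (_ ∈_) e x∈cv)
    ...   | inj₂ (v∈G₂ , e) with ∈-map⁻ τ (subst (_ ∈_) e x∈cv)
    ...     | y , y∈ , refl = into (used-∈⁺ G₂ d₂ v∈G₂ y∈)
    bw : ∀ {x} → x ∈ A₁ → x ∈ usedColours G c
    bw x∈ with used-∈⁻ G₁ d₁ x∈
    ... | v , v∈G₁ , x∈d₁ = used-∈⁺ G c (G₁⇒G v∈G₁) (subst (_ ∈_) (sym (c-on-G₁ v∈G₁)) x∈d₁)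

  c-value : gval G B c ≡ gval G₁ b₁ c₁
  c-value = trans (cong (λ m → ratio m B) (trans c-numColours (·-numColours G₁ c₁ k₁)))
    (ratio-≡ (IsColoring.pos d₁-colouring) (IsColoring.pos col₁) cross)
    where
    N₁ : ℕ
    N₁ = numColours G₁ c₁
    cross : k₁ * N₁ * b₁ ≡ N₁ * B
    cross = trans (cong (_* b₁) (*-comm k₁ N₁)) (*-assoc N₁ k₁ b₁)

  glued : CommonExtension G G₁ G₂ b₁ c₁ b₂ c₂ (gval G₁ b₁ c₁ ⊔ gval G₂ b₂ c₂)
  glued = extension B c c-colouring
    (iso-multiple⇒equiv G₁ k₁ refl c≅d₁)
    (iso-multiple⇒equiv G₂ k₂ (sym B-folds) c≅k₂c₂)
    (trans c-value (sym (p≥q⇒p⊔q≡p g₂≤g₁)))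
    where
    g₂≤g₁ : gval G₂ b₂ c₂ ℚ.≤ gval G₁ b₁ c₁
    g₂≤g₁ = ratio-≤ (IsColoring.pos col₂) (IsColoring.pos col₁) dominant

swap-sides : ∀ {n} {G G₁ G₂ : Graph n} {b₁ c₁ b₂ c₂ g₁ g₂} →
  CommonExtension G G₂ G₁ b₂ c₂ b₁ c₁ (g₂ ⊔ g₁) → CommonExtension G G₁ G₂ b₁ c₁ b₂ c₂ (g₁ ⊔ g₂)
swap-sides {g₁ = g₁} {g₂} (extension b c col equiv₂ equiv₁ val) =
  extension b c col equiv₁ equiv₂ (trans val (ℚ-⊔-comm g₂ g₁))

-- The theorem: glue along the side whose colourings use more colours per unit.
lemma4 : ∀ {n} (G G₁ G₂ H : Graph n)
    → G₁ ⊆G G → G₂ ⊆G G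
    → (∀ v → V G v ≡ V G₁ v ∨ V G₂ v)
    → (∀ u v → E G u v ≡ E G₁ u v ∨ E G₂ u v)
    → (∀ v → V H v ≡ V G₁ v ∧ V G₂ v)
    → (∀ u v → E H u v ≡ E G₁ u v ∧ E G₂ u v)
    → (b₁ : ℕ) (c₁ : Assignment n) → IsColoring G₁ b₁ c₁
    → (b₂ : ℕ) (c₂ : Assignment n) → IsColoring G₂ b₂ c₂
    → Equiv H b₁ c₁ b₂ c₂
    → Σ ℕ λ b → Σ (Assignment n) λ c →
        IsColoring G b c
        × Equiv G₁ b c b₁ c₁
        × Equiv G₂ b c b₂ c₂
        × gval G b c ≡ gval G₁ b₁ c₁ ⊔ gval G₂ b₂ c₂
lemma4 G G₁ G₂ H _ _ V-union E-union V-meet _ b₁ c₁ col₁ b₂ c₂ col₂ (s , s≥1 , H-iso) =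
  unpack ([ glue-into-G₁ , glue-into-G₂ ]′
           (≤-total (numColours G₂ c₂ * b₁) (numColours G₁ c₁ * b₂)))
  where
  Goal : Set
  Goal = CommonExtension G G₁ G₂ b₁ c₁ b₂ c₂ (gval G₁ b₁ c₁ ⊔ gval G₂ b₂ c₂)

  glue-into-G₁ : numColours G₂ c₂ * b₁ ≤ numColours G₁ c₁ * b₂ → Goal
  glue-into-G₁ = Gluing.glued G G₁ G₂ H V-union E-union V-meet col₁ col₂ s s≥1 H-iso

  glue-into-G₂ : numColours G₁ c₁ * b₂ ≤ numColours G₂ c₂ * b₁ → Goal
  glue-into-G₂ dominant₂ = swap-sides {g₁ = gval G₁ b₁ c₁} {gval G₂ b₂ c₂} (Gluing.glued G G₂ G₁ H
    (λ v → trans (V-union v) (∨-comm (V G₁ v) (V G₂ v)))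
    (λ u v → trans (E-union u v) (∨-comm (E G₁ u v) (E G₂ u v)))
    (λ v → trans (V-meet v) (∧-comm (V G₁ v) (V G₂ v)))
    col₂ col₁ s s≥1 (iso-sym H H-iso) dominant₂)

  unpack : Goal → Σ ℕ λ b → Σ (Assignment _) λ c → IsColoring G b c × Equiv G₁ b c b₁ c₁
                  × Equiv G₂ b c b₂ c₂ × gval G b c ≡ gval G₁ b₁ c₁ ⊔ gval G₂ b₂ c₂
  unpack (extension b c col equiv₁ equiv₂ val) = b , c , col , equiv₁ , equiv₂ , val
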